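{- Let $n$ be a positive integer and let $k$ be an integer such that $k-1$ is a prime number. Suppose that for every nonnegative integer $r$ and each choice of sign for which $\frac{3r^2\pm r}{2}\leq n-1$, the integer $n-1-\frac{3r^2\pm r}{2}$ is not divisible by $k-1$. Then $\tau_k(n)\equiv 0\pmod{k-1}$.
   Context: For a nonzero integer $k$, the arithmetical function $\tau_k$ is defined by $q\prod_{m=1}^{\infty}(1-q^m)^k=\sum_{n=1}^{\infty}\tau_k(n)q^n$. -}

module Defs where

open import Data.Nat as ℕ using (ℕ; zero; suc; _∸_)
open import Data.Nat.DivMod using (_/_)
open import Data.Nat.Divisibility using (_∣?_)
open import Data.Integer as ℤ using (ℤ; +_; -[1+_])
open import Relation.Nullary.Decidable using (does)
open import Data.Bool using (if_then_else_)

Series : Set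
Series = ℕ → ℤ

sumTo : ℕ → (ℕ → ℤ) → ℤ
sumTo zero    f = f 0
sumTo (suc n) f = sumTo n f ℤ.+ f (suc n)

one : Series
one zero    = + 1
one (suc _) = + 0

_⊛_ : Series → Series → Series
(f ⊛ g) n = sumTo n (λ i → f i ℤ.* g (n ∸ i))

_^ₙ_ : Series → ℕ → Series
f ^ₙ zero  = one
f ^ₙ suc j = f ⊛ (f ^ₙ j)

oneMinusQ^ : ℕ → Series
oneMinusQ^ m zero = + 1
oneMinusQ^ m (suc j) = if does (suc j ℕ.≟ m) then ℤ.- (+ 1) else + 0

-- (1 - q^m)^{-1} = Σ_j q^{mj}  (for m ≥ 1)
invOneMinusQ^ : ℕ → Series
invOneMinusQ^ m j = if does (m ∣? j) then + 1 else + 0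

factorPow : ℕ → ℤ → Series
factorPow m (+ j)     = oneMinusQ^ m ^ₙ j
factorPow m -[1+ j ]  = invOneMinusQ^ m ^ₙ suc j

prodTo : ℕ → ℤ → Series
prodTo zero    k = one
prodTo (suc N) k = factorPow (suc N) k ⊛ prodTo N k

-- τ_k(n) : coefficient of q^n in q ∏_{m≥1} (1-q^m)^k.
-- The coefficient of q^{n-1} in ∏_{m≥1}(1-q^m)^k only depends on factors with m ≤ n-1,
-- so the finite product up to m = n computes it exactly.
τ : ℤ → ℕ → ℤ
τ k zero    = + 0
τ k (suc n) = prodTo (suc n) k n

pentPlus : ℕ → ℕ
pentPlus r = (3 ℕ.* r ℕ.* r ℕ.+ r) / 2

pentMinus : ℕ → ℕ
pentMinus r = (3 ℕ.* r ℕ.* r ∸ r) / 2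

module Submission where

-- With k = p + 1 the product factors as ∏ (1 - q^m) · ∏ (1 - q^m)^p. Modulo p the freshman's
-- dream turns (1 - q^m)^p into 1 - q^{mp}, so the second factor becomes a series supported on
-- multiples of p. By Euler's pentagonal number theorem, derived from Shanks' finite identity, the
-- first factor agrees up to degree n with a series supported on generalised pentagonal numbers.
-- The coefficient of q^{n-1} in the product of these two series is then a sum over decompositions
-- n - 1 = i + j with i pentagonal and p ∣ j, and the hypothesis says that there are none.

open import Algebra.Bundles using (CommutativeRing)
open import Data.Integer as ℤ using (ℤ; -[1+_]; _⊖_; 0ℤ; 1ℤ)
import Data.Integer.Properties as ℤ
open import Data.Maybe using (Maybe; just; nothing)
open import Data.Nat as ℕ using (ℕ; zero; suc; _∸_; z≤n; s≤s)
import Data.Nat.Properties as ℕ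
open import Data.Nat.Combinatorics using (_C_; nC1≡n; nCn≡1; nCk+nC[k+1]≡[n+1]C[k+1])
open import Data.Nat.Divisibility using (_∣_; divides; m∣m*n; n∣m*n; ∣⇒≤; _∣0; ∣m∣n⇒∣m+n)
open import Data.Nat.DivMod using (_/_; m*n/n≡m)
open import Data.Nat.Primality using (Prime; euclidsLemma; ¬prime[0]; prime⇒nonZero)
open import Data.Nat.Tactic.RingSolver using (solve-∀)
open import Data.Product using (∃; _,_)
open import Data.Sum using (_⊎_; inj₁; inj₂)
open import Function using (_∘_)
open import Level using (_⊔_; 0ℓ)
open import Relation.Binary.PropositionalEquality as ≡ using (_≡_; _≢_)
open import Relation.Nullary using (yes; no; ¬_; contradiction)
open import Relation.Nullary.Decidable using (dec-true; dec-false)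

open import Defs

-- The TCOptimised multiplication is used so that ι 0 and
-- ι 1 are definitionally 0# and 1#, which the normal forms produced by the solver rely on.
module IntegerCoefficientSolver {c ℓ} (R : CommutativeRing c ℓ) where

  open CommutativeRing R
  open import Algebra.Properties.Semiring.Mult.TCOptimised semiring using (_×_; 1+×; ×-homo-+; ×1-homo-*)
  open import Algebra.Properties.Ring ring using (-‿distribˡ-*; -‿distribʳ-*; -0#≈0#)
  open import Algebra.Properties.AbelianGroup +-abelianGroup using (⁻¹-∙-comm)
  open import Algebra.Properties.Group +-group using (⁻¹-involutive)
  open import Algebra.Properties.CommutativeSemigroup +-commutativeSemigroup using (interchange)
  open import Algebra.Solver.Ring.AlmostCommutativeRing using (fromCommutativeRing; _-Raw-AlmostCommutative⟶_)
  open import Relation.Binary.Reasoning.Setoid setoid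

  ι : ℤ → Carrier
  ι (ℤ.+ n)  = n × 1#
  ι -[1+ n ] = - (suc n × 1#)

  ι-neg : ∀ i → ι (ℤ.- i) ≈ - ι i
  ι-neg (ℤ.+ zero)  = sym -0#≈0#
  ι-neg (ℤ.+ suc n) = refl
  ι-neg -[1+ n ]    = sym (⁻¹-involutive _)

  ι-⊖ : ∀ m n → ι (m ⊖ n) ≈ m × 1# - n × 1#
  ι-⊖ zero    zero    = sym (-‿inverseʳ 0#)
  ι-⊖ (suc m) zero    = sym (trans (+-congˡ -0#≈0#) (+-identityʳ _))
  ι-⊖ zero    (suc n) = sym (+-identityˡ _)
  ι-⊖ (suc m) (suc n) = begin
    ι (suc m ⊖ suc n)                ≡⟨ ≡.cong ι (ℤ.[1+m]⊖[1+n]≡m⊖n m n) ⟩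
    ι (m ⊖ n)                        ≈⟨ ι-⊖ m n ⟩
    m × 1# - n × 1#                  ≈⟨ +-identityˡ _ ⟨
    0# + (m × 1# - n × 1#)           ≈⟨ +-congʳ (-‿inverseʳ 1#) ⟨
    (1# - 1#) + (m × 1# - n × 1#)    ≈⟨ interchange 1# (- 1#) (m × 1#) (- (n × 1#)) ⟩
    1# + m × 1# + (- 1# - n × 1#)    ≈⟨ +-cong (1+× m 1#) (sym (⁻¹-∙-comm 1# (n × 1#))) ⟨
    suc m × 1# - (1# + n × 1#)       ≈⟨ +-congˡ (-‿cong (1+× n 1#)) ⟨
    suc m × 1# - suc n × 1#          ∎

  ι-+ : ∀ i j → ι (i ℤ.+ j) ≈ ι i + ι j
  ι-+ (ℤ.+ m)  (ℤ.+ n)  = ×-homo-+ 1# m n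
  ι-+ (ℤ.+ m)  -[1+ n ] = ι-⊖ m (suc n)
  ι-+ -[1+ m ] (ℤ.+ n)  = trans (ι-⊖ n (suc m)) (+-comm _ _)
  ι-+ -[1+ m ] -[1+ n ] = begin
    - (suc (suc (m ℕ.+ n)) × 1#)       ≡⟨ ≡.cong (λ k → - (k × 1#)) (≡.sym (ℕ.+-suc (suc m) n)) ⟩
    - ((suc m ℕ.+ suc n) × 1#)         ≈⟨ -‿cong (×-homo-+ 1# (suc m) (suc n)) ⟩
    - (suc m × 1# + suc n × 1#)        ≈⟨ ⁻¹-∙-comm _ _ ⟨
    - (suc m × 1#) + - (suc n × 1#)    ∎

  ι-*-+ : ∀ m j → ι (ℤ.+ m ℤ.* j) ≈ ι (ℤ.+ m) * ι j
  ι-*-+ m (ℤ.+ n)  = trans (reflexive (≡.cong ι (≡.sym (ℤ.pos-* m n)))) (×1-homo-* m n)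
  ι-*-+ m -[1+ n ] = begin
    ι (ℤ.+ m ℤ.* ℤ.- ℤ.+ suc n)      ≡⟨ ≡.cong ι (≡.sym (ℤ.neg-distribʳ-* (ℤ.+ m) (ℤ.+ suc n))) ⟩
    ι (ℤ.- (ℤ.+ m ℤ.* ℤ.+ suc n))    ≈⟨ ι-neg (ℤ.+ m ℤ.* ℤ.+ suc n) ⟩
    - ι (ℤ.+ m ℤ.* ℤ.+ suc n)        ≈⟨ -‿cong (ι-*-+ m (ℤ.+ suc n)) ⟩
    - (m × 1# * suc n × 1#)          ≈⟨ -‿distribʳ-* _ _ ⟩
    m × 1# * - (suc n × 1#)          ∎

  ι-* : ∀ i j → ι (i ℤ.* j) ≈ ι i * ι j
  ι-* (ℤ.+ m)  j = ι-*-+ m j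
  ι-* -[1+ m ] j = begin
    ι (ℤ.- ℤ.+ suc m ℤ.* j)          ≡⟨ ≡.cong ι (≡.sym (ℤ.neg-distribˡ-* (ℤ.+ suc m) j)) ⟩
    ι (ℤ.- (ℤ.+ suc m ℤ.* j))        ≈⟨ ι-neg (ℤ.+ suc m ℤ.* j) ⟩
    - ι (ℤ.+ suc m ℤ.* j)            ≈⟨ -‿cong (ι-*-+ (suc m) j) ⟩
    - (suc m × 1# * ι j)             ≈⟨ -‿distribˡ-* _ _ ⟩
    - (suc m × 1#) * ι j             ∎

  ι-homomorphism : CommutativeRing.rawRing ℤ.+-*-commutativeRing -Raw-AlmostCommutative⟶ fromCommutativeRing R
  ι-homomorphism = record
    { ⟦_⟧    = ι
    ; +-homo = ι-+
    ; *-homo = ι-*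
    ; -‿homo = ι-neg
    ; 0-homo = refl
    ; 1-homo = refl
    }

  ι-≟ : ∀ i j → Maybe (ι i ≈ ι j)
  ι-≟ i j with i ℤ.≟ j
  ... | yes ≡.refl = just refl
  ... | no _       = nothing

  open import Algebra.Solver.Ring _ _ ι-homomorphism ι-≟ public

module FiniteProducts {c ℓ} (R : CommutativeRing c ℓ) where

  open CommutativeRing R
  open IntegerCoefficientSolver R
  open import Relation.Binary.Reasoning.Setoid setoid

  ∑< : ℕ → (ℕ → Carrier) → Carrier
  ∑< zero    f = 0#
  ∑< (suc n) f = ∑< n f + f n

  ∏< : ℕ → (ℕ → Carrier) → Carrier
  ∏< zero    f = 1#
  ∏< (suc n) f = f n * ∏< n f

  ∏<-cong : ∀ n {f g : ℕ → Carrier} → (∀ i → f i ≈ g i) → ∏< n f ≈ ∏< n g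
  ∏<-cong zero    f≈g = refl
  ∏<-cong (suc n) f≈g = *-cong (f≈g n) (∏<-cong n f≈g)

  ∏<-distrib-* : ∀ n (f g : ℕ → Carrier) → ∏< n (λ i → f i * g i) ≈ ∏< n f * ∏< n g
  ∏<-distrib-* zero    f g = sym (*-identityˡ 1#)
  ∏<-distrib-* (suc n) f g = begin
    f n * g n * ∏< n (λ i → f i * g i)  ≈⟨ *-congˡ (∏<-distrib-* n f g) ⟩
    f n * g n * (∏< n f * ∏< n g)       ≈⟨ solve 4 (λ a b x y → a :* b :* (x :* y) := a :* x :* (b :* y))
                                                  refl (f n) (g n) (∏< n f) (∏< n g) ⟩
    f n * ∏< n f * (g n * ∏< n g)       ∎

  ∏<-suc : ∀ n (f : ℕ → Carrier) → ∏< (suc n) f ≈ ∏< n (f ∘ suc) * f 0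
  ∏<-suc zero    f = *-comm (f 0) 1#
  ∏<-suc (suc n) f = begin
    f (suc n) * (f n * ∏< n f)          ≈⟨ *-congˡ (∏<-suc n f) ⟩
    f (suc n) * (∏< n (f ∘ suc) * f 0)  ≈⟨ *-assoc _ _ _ ⟨
    f (suc n) * ∏< n (f ∘ suc) * f 0    ∎

module Congruence {c ℓ} (R : CommutativeRing c ℓ) where

  open CommutativeRing R
  open IntegerCoefficientSolver R
  open FiniteProducts R
  open import Algebra.Properties.Semiring.Exp semiring using (_^_; ^-homo-*)
  open import Relation.Binary.Bundles using (Preorder)
  open import Relation.Binary.Reasoning.Setoid setoid

  infix 4 _≈_mod_
  _≈_mod_ : Carrier → Carrier → Carrier → Set (c ⊔ ℓ)
  x ≈ y mod d = ∃ λ z → x ≈ y + d * z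

  module _ {d : Carrier} where

    ≈⇒≈mod : ∀ {x y} → x ≈ y → x ≈ y mod d
    ≈⇒≈mod {y = y} x≈y = 0# , trans x≈y (solve 2 (λ y d → y := y :+ d :* con 0ℤ) refl y d)

    ≈mod-sym : ∀ {x y} → x ≈ y mod d → y ≈ x mod d
    ≈mod-sym {x} {y} (a , x≈y+da) = - a , (begin
      y                      ≈⟨ solve 3 (λ y d a → y := y :+ d :* a :+ d :* (:- a)) refl y d a ⟩
      y + d * a + d * - a    ≈⟨ +-congʳ x≈y+da ⟨
      x + d * - a            ∎)

    ≈mod-trans : ∀ {x y z} → x ≈ y mod d → y ≈ z mod d → x ≈ z mod d
    ≈mod-trans {x} {y} {z} (a , x≈y+da) (b , y≈z+db) = b + a , (begin
      x                      ≈⟨ x≈y+da ⟩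
      y + d * a              ≈⟨ +-congʳ y≈z+db ⟩
      z + d * b + d * a      ≈⟨ solve 4 (λ z d a b → z :+ d :* b :+ d :* a := z :+ d :* (b :+ a)) refl z d a b ⟩
      z + d * (b + a)        ∎)

    ≈mod-respˡ : ∀ {x x′ y} → x ≈ x′ → x ≈ y mod d → x′ ≈ y mod d
    ≈mod-respˡ x≈x′ (a , x≈y+da) = a , trans (sym x≈x′) x≈y+da

    ≈mod-respʳ : ∀ {x y y′} → y ≈ y′ → x ≈ y mod d → x ≈ y′ mod d
    ≈mod-respʳ y≈y′ (a , x≈y+da) = a , trans x≈y+da (+-congʳ y≈y′)

    ≈mod-preorder : Preorder c ℓ (c ⊔ ℓ)
    ≈mod-preorder = record
      { _≲_        = _≈_mod d
      ; isPreorder = record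
        { isEquivalence = isEquivalence
        ; reflexive     = ≈⇒≈mod
        ; trans         = ≈mod-trans
        }
      }

    +-cong-mod : ∀ {x y u v} → x ≈ y mod d → u ≈ v mod d → x + u ≈ y + v mod d
    +-cong-mod {y = y} {v = v} (a , x≈y+da) (b , u≈v+db) = a + b , (begin
      _ + _                      ≈⟨ +-cong x≈y+da u≈v+db ⟩
      y + d * a + (v + d * b)    ≈⟨ solve 5 (λ y v d a b → y :+ d :* a :+ (v :+ d :* b) := y :+ v :+ d :* (a :+ b))
                                            refl y v d a b ⟩
      y + v + d * (a + b)        ∎)

    *-cong-mod : ∀ {x y u v} → x ≈ y mod d → u ≈ v mod d → x * u ≈ y * v mod d
    *-cong-mod {y = y} {v = v} (a , x≈y+da) (b , u≈v+db) = a * v + y * b + d * a * b , (begin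
      _ * _                                      ≈⟨ *-cong x≈y+da u≈v+db ⟩
      (y + d * a) * (v + d * b)                  ≈⟨ solve 5 (λ y v d a b → (y :+ d :* a) :* (v :+ d :* b)
                                                                      := y :* v :+ d :* (a :* v :+ y :* b :+ d :* a :* b))
                                                          refl y v d a b ⟩
      y * v + d * (a * v + y * b + d * a * b)    ∎)

    *-congˡ-mod : ∀ {x y} u → x ≈ y mod d → u * x ≈ u * y mod d
    *-congˡ-mod u = *-cong-mod (≈⇒≈mod refl)

    *-congʳ-mod : ∀ {x y} u → x ≈ y mod d → x * u ≈ y * u mod d
    *-congʳ-mod u x≈y = *-cong-mod x≈y (≈⇒≈mod refl)

    d*x≈0-mod : ∀ x → d * x ≈ 0# mod d
    d*x≈0-mod x = x , sym (+-identityˡ _)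

    ∑<-≈-head-mod : ∀ n (f : ℕ → Carrier) → (∀ k → k ℕ.< n → f (suc k) ≈ 0# mod d) →
                    ∑< (suc n) f ≈ f 0 mod d
    ∑<-≈-head-mod zero    f tail≈0 = ≈⇒≈mod (+-identityˡ (f 0))
    ∑<-≈-head-mod (suc n) f tail≈0 = ≈mod-respʳ (+-identityʳ (f 0))
      (+-cong-mod (∑<-≈-head-mod n f (λ k k<n → tail≈0 k (ℕ.m<n⇒m<1+n k<n))) (tail≈0 n ℕ.≤-refl))

    ∏<-cong-mod : ∀ n {f g : ℕ → Carrier} → (∀ i → f i ≈ g i mod d) → ∏< n f ≈ ∏< n g mod d
    ∏<-cong-mod zero    f≈g = ≈⇒≈mod refl
    ∏<-cong-mod (suc n) f≈g = *-cong-mod (f≈g n) (∏<-cong-mod n f≈g)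

  ^-≈0-mod : ∀ x {m n} → m ℕ.≤ n → x ^ n ≈ 0# mod x ^ m
  ^-≈0-mod x {m} {n} m≤n = ≈mod-respˡ (begin
    x ^ m * x ^ (n ∸ m)    ≈⟨ ^-homo-* x m (n ∸ m) ⟨
    x ^ (m ℕ.+ (n ∸ m))    ≡⟨ ≡.cong (x ^_) (ℕ.m+[n∸m]≡n m≤n) ⟩
    x ^ n                  ∎) (d*x≈0-mod (x ^ (n ∸ m)))

[1+k]*[1+n]C[1+k]≡[1+n]*nCk : ∀ n k → suc k ℕ.* (suc n C suc k) ≡ suc n ℕ.* (n C k)
[1+k]*[1+n]C[1+k]≡[1+n]*nCk zero    zero    = ≡.refl
[1+k]*[1+n]C[1+k]≡[1+n]*nCk zero    (suc k) = ℕ.*-zeroʳ (suc (suc k))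
[1+k]*[1+n]C[1+k]≡[1+n]*nCk (suc n) zero    =
  ≡.trans (ℕ.+-identityʳ _) (≡.trans (nC1≡n (suc (suc n))) (≡.sym (ℕ.*-identityʳ _)))
[1+k]*[1+n]C[1+k]≡[1+n]*nCk (suc n) (suc k) = begin
  suc (suc k) * (suc N C suc (suc k))
    ≡⟨ ≡.cong (suc (suc k) *_) (nCk+nC[k+1]≡[n+1]C[k+1] N (suc k)) ⟨
  suc (suc k) * (N C suc k + N C suc (suc k))
    ≡⟨ ℕ.*-distribˡ-+ (suc (suc k)) (N C suc k) _ ⟩
  N C suc k + suc k * (N C suc k) + suc (suc k) * (N C suc (suc k))
    ≡⟨ ≡.cong₂ (λ a b → N C suc k + a + b) ([1+k]*[1+n]C[1+k]≡[1+n]*nCk n k)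
                                           ([1+k]*[1+n]C[1+k]≡[1+n]*nCk n (suc k)) ⟩
  N C suc k + N * (n C k) + N * (n C suc k)
    ≡⟨ ℕ.+-assoc (N C suc k) _ _ ⟩
  N C suc k + (N * (n C k) + N * (n C suc k))
    ≡⟨ ≡.cong (λ c → N C suc k + c) (ℕ.*-distribˡ-+ N (n C k) _) ⟨
  N C suc k + N * (n C k + n C suc k)
    ≡⟨ ≡.cong (λ c → N C suc k + N * c) (nCk+nC[k+1]≡[n+1]C[k+1] n k) ⟩
  suc N * (N C suc k)
    ∎
  where
  open ≡.≡-Reasoning
  open import Data.Nat using (_*_; _+_)
  N = suc n

prime∣pCk : ∀ {p k} → Prime p → 0 ℕ.< k → k ℕ.< p → p ∣ p C k
prime∣pCk {suc n} {suc k} p-prime _ k<p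
  with euclidsLemma (suc k) (suc n C suc k) p-prime
         (≡.subst (suc n ∣_) (≡.sym ([1+k]*[1+n]C[1+k]≡[1+n]*nCk n k)) (m∣m*n (n C k)))
... | inj₁ p∣k   = contradiction (∣⇒≤ p∣k) (ℕ.<⇒≱ k<p)
... | inj₂ p∣pCk = p∣pCk

module Frobenius {c ℓ} (R : CommutativeRing c ℓ) where

  open CommutativeRing R
  open IntegerCoefficientSolver R
  open FiniteProducts R
  open Congruence R
  open import Algebra.Properties.Semiring.Exp semiring using (_^_)
  open import Algebra.Properties.Semiring.Mult semiring using (_×_; ×-homo-1; ×-congʳ; ×-assocˡ; ×-assoc-*)
  open import Algebra.Properties.Monoid.Sum +-monoid using (sum; sum-init-last)
  import Algebra.Properties.Monoid.Mult *-monoid as Power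
  open import Algebra.Properties.CommutativeSemiring.Binomial commutativeSemiring using (theorem; binomialTerm)
  open import Data.Fin as Fin using (Fin; fromℕ; inject₁)
  open import Data.Fin.Properties using (toℕ-fromℕ; inject₁ℕ<)

  ∣⇒×≈0-mod : ∀ {d m} x → d ∣ m → m × x ≈ 0# mod d × 1#
  ∣⇒×≈0-mod {d} x (divides k ≡.refl) = k × x , (begin
    (k ℕ.* d) × x          ≡⟨ ≡.cong (_× x) (ℕ.*-comm k d) ⟩
    (d ℕ.* k) × x          ≈⟨ ×-assocˡ x d k ⟨
    d × (k × x)            ≈⟨ ×-congʳ d (*-identityˡ (k × x)) ⟨
    d × (1# * k × x)       ≈⟨ ×-assoc-* d 1# (k × x) ⟨
    d × 1# * k × x         ≈⟨ +-identityˡ _ ⟨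
    0# + d × 1# * k × x    ∎)
    where open import Relation.Binary.Reasoning.Setoid setoid

  sum-≈0-mod : ∀ {d n} (t : Fin n → Carrier) → (∀ i → t i ≈ 0# mod d) → sum t ≈ 0# mod d
  sum-≈0-mod {n = zero}  t t≈0 = ≈⇒≈mod refl
  sum-≈0-mod {n = suc n} t t≈0 =
    ≈mod-respʳ (+-identityˡ 0#) (+-cong-mod (t≈0 Fin.zero) (sum-≈0-mod (t ∘ Fin.suc) (t≈0 ∘ Fin.suc)))

  binomialTerm-first : ∀ x y n → binomialTerm x y n Fin.zero ≈ y ^ n
  binomialTerm-first x y n = trans (×-homo-1 _) (*-identityˡ (y ^ n))

  binomialTerm-last : ∀ x y n → binomialTerm x y n (fromℕ n) ≈ x ^ n
  binomialTerm-last x y n rewrite toℕ-fromℕ n | nCn≡1 n | ℕ.n∸n≡0 n = trans (×-homo-1 _) (*-identityʳ (x ^ n))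

  freshman's-dream : ∀ {p} → Prime p → ∀ x y → (x + y) ^ p ≈ x ^ p + y ^ p mod p × 1#
  freshman's-dream {zero}  0-prime = contradiction 0-prime ¬prime[0]
  freshman's-dream {suc n} p-prime x y = begin
    (x + y) ^ p                                    ≈⟨ theorem p x y ⟩
    term Fin.zero + sum (term ∘ Fin.suc)           ≈⟨ +-congˡ (sum-init-last (term ∘ Fin.suc)) ⟩
    term Fin.zero + (sum inner + term (fromℕ p))
      ≲⟨ +-cong-mod (≈⇒≈mod refl) (+-cong-mod (sum-≈0-mod inner inner≈0) (≈⇒≈mod refl)) ⟩
    term Fin.zero + (0# + term (fromℕ p))          ≈⟨ +-cong (binomialTerm-first x y p) (+-identityˡ _) ⟩
    y ^ p + term (fromℕ p)                         ≈⟨ +-congˡ (binomialTerm-last x y p) ⟩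
    y ^ p + x ^ p                                  ≈⟨ +-comm _ _ ⟩
    x ^ p + y ^ p                                  ∎
    where
    open import Relation.Binary.Reasoning.Preorder (≈mod-preorder {suc n × 1#})
    p = suc n
    term = binomialTerm x y p
    inner : Fin n → Carrier
    inner i = term (Fin.suc (inject₁ i))
    inner≈0 : ∀ i → inner i ≈ 0# mod p × 1#
    inner≈0 i = ∣⇒×≈0-mod _ (prime∣pCk p-prime (s≤s z≤n) (s≤s (inject₁ℕ< i)))

  -- The freshman's dream for x and -x, whose sum is 0, handles p = 2 and odd p alike.
  neg-^-mod : ∀ {p} → Prime p → ∀ x → (- x) ^ p ≈ - (x ^ p) mod p × 1#
  neg-^-mod {zero}  0-prime = contradiction 0-prime ¬prime[0]
  neg-^-mod {suc n} p-prime x = begin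
    (- x) ^ p                        ≈⟨ solve 2 (λ a b → b := :- a :+ (a :+ b)) refl (x ^ p) ((- x) ^ p) ⟩
    - x ^ p + (x ^ p + (- x) ^ p)
      ≲⟨ +-cong-mod (≈⇒≈mod refl) (≈mod-sym (≈mod-respˡ [x-x]^p≈0 (freshman's-dream p-prime x (- x)))) ⟩
    - x ^ p + 0#                     ≈⟨ +-identityʳ _ ⟩
    - x ^ p                          ∎
    where
    open import Relation.Binary.Reasoning.Preorder (≈mod-preorder {suc n × 1#})
    p = suc n
    [x-x]^p≈0 : (x + - x) ^ p ≈ 0#
    [x-x]^p≈0 = trans (*-congʳ (-‿inverseʳ x)) (zeroˡ _)

  [1-x]^p≈1-x^p-mod : ∀ {p} → Prime p → ∀ x → (1# - x) ^ p ≈ 1# - x ^ p mod p × 1#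
  [1-x]^p≈1-x^p-mod {p} p-prime x = begin
    (1# - x) ^ p          ≲⟨ freshman's-dream p-prime 1# (- x) ⟩
    1# ^ p + (- x) ^ p    ≲⟨ +-cong-mod (≈⇒≈mod refl) (neg-^-mod p-prime x) ⟩
    1# ^ p - x ^ p        ≈⟨ +-congʳ (Power.×-idem (*-identityʳ 1#) p {{prime⇒nonZero p-prime}}) ⟩
    1# - x ^ p            ∎
    where open import Relation.Binary.Reasoning.Preorder (≈mod-preorder {p × 1#})

  ∏<-[1-x]^[1+p]-mod : ∀ {p} → Prime p → ∀ n (x : ℕ → Carrier) →
    ∏< n (λ i → (1# - x i) ^ suc p) ≈ ∏< n (λ i → 1# - x i) * ∏< n (λ i → 1# - x i ^ p) mod p × 1#
  ∏<-[1-x]^[1+p]-mod p-prime n x = ≈mod-respʳ (∏<-distrib-* n _ _)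
    (∏<-cong-mod n (λ i → *-congˡ-mod (1# - x i) ([1-x]^p≈1-x^p-mod p-prime (x i))))

triangular : ℕ → ℕ
triangular zero    = 0
triangular (suc k) = triangular k ℕ.+ suc k

triangular*2 : ∀ k → triangular k ℕ.* 2 ≡ k ℕ.* suc k
triangular*2 zero    = ≡.refl
triangular*2 (suc k) = begin
  (triangular k + suc k) * 2      ≡⟨ ℕ.*-distribʳ-+ 2 (triangular k) (suc k) ⟩
  triangular k * 2 + suc k * 2    ≡⟨ ≡.cong (_+ suc k * 2) (triangular*2 k) ⟩
  k * suc k + suc k * 2           ≡⟨ expand k ⟩
  suc k * suc (suc k)             ∎
  where
  open ≡.≡-Reasoning
  open import Data.Nat using (_*_; _+_)
  expand : ∀ k → k * suc k + suc k * 2 ≡ suc k * suc (suc k)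
  expand = solve-∀

pentPlus≡ : ∀ r → pentPlus r ≡ r ℕ.* r ℕ.+ triangular r
pentPlus≡ r = begin
  (3 * r * r + r) / 2                   ≡⟨ ≡.cong (_/ 2) twice ⟩
  (r * r + triangular r) * 2 / 2        ≡⟨ m*n/n≡m _ 2 ⟩
  r * r + triangular r                  ∎
  where
  open ≡.≡-Reasoning
  open import Data.Nat using (_*_; _+_)
  expand : ∀ r → 3 * r * r + r ≡ r * r * 2 + r * suc r
  expand = solve-∀
  twice : 3 * r * r + r ≡ (r * r + triangular r) * 2
  twice = begin
    3 * r * r + r                       ≡⟨ expand r ⟩
    r * r * 2 + r * suc r               ≡⟨ ≡.cong (λ t → r * r * 2 + t) (triangular*2 r) ⟨
    r * r * 2 + triangular r * 2        ≡⟨ ℕ.*-distribʳ-+ 2 (r * r) _ ⟨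
    (r * r + triangular r) * 2          ∎

pentMinus-suc : ∀ r → pentMinus (suc r) ≡ suc r ℕ.+ r ℕ.+ pentPlus r
pentMinus-suc r = begin
  (3 * suc r * suc r ∸ suc r) / 2       ≡⟨ ≡.cong (λ n → (n ∸ suc r) / 2) twice ⟩
  (s * 2 + suc r ∸ suc r) / 2           ≡⟨ ≡.cong (_/ 2) (ℕ.m+n∸n≡m (s * 2) (suc r)) ⟩
  s * 2 / 2                             ≡⟨ m*n/n≡m s 2 ⟩
  s                                     ∎
  where
  open ≡.≡-Reasoning
  open import Data.Nat using (_*_; _+_)
  s = suc r + r + pentPlus r
  a = suc r + r + r * r
  expand : ∀ r → 3 * suc r * suc r ≡ (suc r + r + r * r) * 2 + r * suc r + suc r
  expand = solve-∀
  twice : 3 * suc r * suc r ≡ s * 2 + suc r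
  twice = begin
    3 * suc r * suc r                                     ≡⟨ expand r ⟩
    a * 2 + r * suc r + suc r                             ≡⟨ ≡.cong (λ t → a * 2 + t + suc r) (triangular*2 r) ⟨
    a * 2 + triangular r * 2 + suc r                      ≡⟨ ≡.cong (_+ suc r) (ℕ.*-distribʳ-+ 2 a _) ⟨
    (a + triangular r) * 2 + suc r                        ≡⟨ ≡.cong (λ t → t * 2 + suc r) (ℕ.+-assoc (suc r + r) (r * r) _) ⟩
    (suc r + r + (r * r + triangular r)) * 2 + suc r      ≡⟨ ≡.cong (λ t → (suc r + r + t) * 2 + suc r) (pentPlus≡ r) ⟨
    s * 2 + suc r                                         ∎

module PentagonalNumberTheorem {c ℓ} (R : CommutativeRing c ℓ) (q : CommutativeRing.Carrier R) where

  open CommutativeRing R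
  open IntegerCoefficientSolver R
  open FiniteProducts R
  open Congruence R
  open import Algebra.Properties.Semiring.Exp semiring using (_^_; ^-homo-*; ^-congʳ)
  open import Relation.Binary.Reasoning.Setoid setoid

  -- pochhammer k d = (q^{k+1}; q)_d, and shanksTerm k d is the k-th term
  -- (-1)^k q^{mk + k(k+1)/2} (q^{k+1}; q)_{m-k} of Shanks' finite sum for m = k + d.
  pochhammer : ℕ → ℕ → Carrier
  pochhammer k d = ∏< d (λ i → 1# - q ^ suc (k ℕ.+ i))

  eulerProduct : ℕ → Carrier
  eulerProduct = pochhammer 0

  shanksTerm : ℕ → ℕ → Carrier
  shanksTerm k d = (- 1#) ^ k * (q ^ ((k ℕ.+ d) ℕ.* k ℕ.+ triangular k) * pochhammer k d)

  shanksSum : ℕ → Carrier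
  shanksSum m = ∑< (suc m) (λ k → shanksTerm k (m ∸ k))

  eulerSum : ℕ → Carrier
  eulerSum zero    = 1#
  eulerSum (suc m) = eulerSum m + (- 1#) ^ suc m * (q ^ pentPlus (suc m) + q ^ pentMinus (suc m))

  pochhammer-suc : ∀ k d → pochhammer k (suc d) ≈ pochhammer (suc k) d * (1# - q ^ suc k)
  pochhammer-suc k d = begin
    pochhammer k (suc d)
      ≈⟨ ∏<-suc d _ ⟩
    ∏< d (λ i → 1# - q ^ suc (k ℕ.+ suc i)) * (1# - q ^ suc (k ℕ.+ 0))
      ≈⟨ *-cong (∏<-cong d (λ i → +-congˡ (-‿cong (^-congʳ q (≡.cong suc (ℕ.+-suc k i))))))
                (+-congˡ (-‿cong (^-congʳ q (≡.cong suc (ℕ.+-identityʳ k))))) ⟩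
    pochhammer (suc k) d * (1# - q ^ suc k)
      ∎

  shanksTerm-sucʳ : ∀ k d → shanksTerm k (suc d) ≈ q ^ k * ((1# - q ^ suc (k ℕ.+ d)) * shanksTerm k d)
  shanksTerm-sucʳ k d = begin
    s * (q ^ ((k ℕ.+ suc d) ℕ.* k ℕ.+ triangular k) * ((1# - Q) * W))
      ≈⟨ *-congˡ (*-congʳ (trans (^-congʳ q (exponent k d (triangular k))) (^-homo-* q k e))) ⟩
    s * (q ^ k * q ^ e * ((1# - Q) * W))
      ≈⟨ solve 5 (λ s a b Q W → s :* (a :* b :* ((con 1ℤ :- Q) :* W)) := a :* ((con 1ℤ :- Q) :* (s :* (b :* W))))
               refl s (q ^ k) (q ^ e) Q W ⟩
    q ^ k * ((1# - Q) * shanksTerm k d)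
      ∎
    where
    s = (- 1#) ^ k
    Q = q ^ suc (k ℕ.+ d)
    W = pochhammer k d
    e = (k ℕ.+ d) ℕ.* k ℕ.+ triangular k
    exponent : ∀ k d t → (k ℕ.+ suc d) ℕ.* k ℕ.+ t ≡ k ℕ.+ ((k ℕ.+ d) ℕ.* k ℕ.+ t)
    exponent = solve-∀

  shanksTerm-sucˡ : ∀ j d →
    (q ^ suc j - 1#) * shanksTerm (suc j) d ≈ q ^ (suc (suc j ℕ.+ d) ℕ.+ j) * shanksTerm j (suc d)
  shanksTerm-sucˡ j d = begin
    (Q - 1#) * ((- 1# * s) * (q ^ e₁ * W))
      ≈⟨ *-congˡ (*-congˡ (*-congʳ (trans (^-congʳ q (≡.sym (exponent j d (triangular j)))) (^-homo-* q a e₀)))) ⟩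
    (Q - 1#) * ((- 1# * s) * (q ^ a * q ^ e₀ * W))
      ≈⟨ solve 5 (λ A s E W Q → (Q :- con 1ℤ) :* ((:- con 1ℤ :* s) :* (A :* E :* W))
                                  := A :* (s :* (E :* (W :* (con 1ℤ :- Q)))))
               refl (q ^ a) s (q ^ e₀) W Q ⟩
    q ^ a * (s * (q ^ e₀ * (W * (1# - Q))))
      ≈⟨ *-congˡ (*-congˡ (*-congˡ (pochhammer-suc j d))) ⟨
    q ^ a * shanksTerm j (suc d)
      ∎
    where
    s = (- 1#) ^ j
    Q = q ^ suc j
    W = pochhammer (suc j) d
    a = suc (suc j ℕ.+ d) ℕ.+ j
    e₀ = (j ℕ.+ suc d) ℕ.* j ℕ.+ triangular j
    e₁ = (suc j ℕ.+ d) ℕ.* suc j ℕ.+ triangular (suc j)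
    exponent : ∀ j d t → suc (suc j ℕ.+ d) ℕ.+ j ℕ.+ ((j ℕ.+ suc d) ℕ.* j ℕ.+ t) ≡
                         (suc j ℕ.+ d) ℕ.* suc j ℕ.+ (t ℕ.+ suc j)
    exponent = solve-∀

  shanks-recurrence : ∀ m j → j ℕ.≤ m →
    ∑< (suc j) (λ k → shanksTerm k (suc m ∸ k)) ≈
    ∑< (suc j) (λ k → shanksTerm k (m ∸ k)) - q ^ (suc m ℕ.+ j) * shanksTerm j (m ∸ j)
  shanks-recurrence m zero _ = begin
    0# + shanksTerm 0 (suc m)
      ≈⟨ +-congˡ (shanksTerm-sucʳ 0 m) ⟩
    0# + 1# * ((1# - Q) * T)
      ≈⟨ solve 2 (λ Q T → con 0ℤ :+ con 1ℤ :* ((con 1ℤ :- Q) :* T) := con 0ℤ :+ T :- Q :* T) refl Q T ⟩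
    0# + T - Q * T
      ≈⟨ +-congˡ (-‿cong (*-congʳ (^-congʳ q (≡.cong suc (≡.sym (ℕ.+-identityʳ m)))))) ⟩
    0# + T - q ^ (suc m ℕ.+ 0) * T
      ∎
    where
    Q = q ^ suc m
    T = shanksTerm 0 m
  shanks-recurrence m (suc j) 1+j≤m = begin
    ∑< (suc j) (λ k → shanksTerm k (suc m ∸ k)) + shanksTerm (suc j) (m ∸ j)
      ≈⟨ +-cong (shanks-recurrence m j (ℕ.<⇒≤ 1+j≤m)) (reflexive (≡.cong (shanksTerm (suc j)) m∸j≡1+d)) ⟩
    S - q ^ (suc m ℕ.+ j) * shanksTerm j (m ∸ j) + shanksTerm (suc j) (suc d)
      ≈⟨ +-cong (+-congˡ (-‿cong lower)) (shanksTerm-sucʳ (suc j) d) ⟩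
    S - (Q - 1#) * T + Q * ((1# - Q′) * T)
      ≈⟨ solve 4 (λ S Q Q′ T → S :- (Q :- con 1ℤ) :* T :+ Q :* ((con 1ℤ :- Q′) :* T) := S :+ T :- Q′ :* Q :* T)
               refl S Q Q′ T ⟩
    S + T - Q′ * Q * T
      ≈⟨ +-congˡ (-‿cong (*-congʳ (trans (sym (^-homo-* q (suc (suc j ℕ.+ d)) (suc j)))
                                         (^-congʳ q (≡.cong (λ n → suc n ℕ.+ suc j) 1+j+d≡m))))) ⟩
    S + T - q ^ (suc m ℕ.+ suc j) * T
      ∎
    where
    d = m ∸ suc j
    m∸j≡1+d : m ∸ j ≡ suc d
    m∸j≡1+d = ℕ.+-∸-assoc 1 1+j≤m
    1+j+d≡m : suc j ℕ.+ d ≡ m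
    1+j+d≡m = ℕ.m+[n∸m]≡n 1+j≤m
    S = ∑< (suc j) (λ k → shanksTerm k (m ∸ k))
    Q = q ^ suc j
    Q′ = q ^ suc (suc j ℕ.+ d)
    T = shanksTerm (suc j) d
    lower : q ^ (suc m ℕ.+ j) * shanksTerm j (m ∸ j) ≈ (Q - 1#) * T
    lower = begin
      q ^ (suc m ℕ.+ j) * shanksTerm j (m ∸ j)
        ≡⟨ ≡.cong₂ (λ n e → q ^ (suc n ℕ.+ j) * shanksTerm j e) (≡.sym 1+j+d≡m) m∸j≡1+d ⟩
      q ^ (suc (suc j ℕ.+ d) ℕ.+ j) * shanksTerm j (suc d)
        ≈⟨ shanksTerm-sucˡ j d ⟨
      (Q - 1#) * T
        ∎

  shanksTerm-zero : ∀ k → shanksTerm k 0 ≈ (- 1#) ^ k * q ^ pentPlus k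
  shanksTerm-zero k = *-congˡ (trans (*-identityʳ _) (^-congʳ q exponent))
    where
    exponent : (k ℕ.+ 0) ℕ.* k ℕ.+ triangular k ≡ pentPlus k
    exponent = ≡.trans (≡.cong (λ n → n ℕ.* k ℕ.+ triangular k) (ℕ.+-identityʳ k)) (≡.sym (pentPlus≡ k))

  shanks-identity : ∀ m → shanksSum m ≈ eulerSum m
  shanks-identity zero    = solve 0 (con 0ℤ :+ con 1ℤ :* (con 1ℤ :* con 1ℤ) := con 1ℤ) refl
  shanks-identity (suc m) = begin
    ∑< (suc m) (λ k → shanksTerm k (suc m ∸ k)) + shanksTerm (suc m) (m ∸ m)
      ≈⟨ +-congʳ (shanks-recurrence m m ℕ.≤-refl) ⟩
    shanksSum m - A * shanksTerm m (m ∸ m) + shanksTerm (suc m) (m ∸ m)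
      ≡⟨ ≡.cong (λ d → shanksSum m - A * shanksTerm m d + shanksTerm (suc m) d) (ℕ.n∸n≡0 m) ⟩
    shanksSum m - A * shanksTerm m 0 + shanksTerm (suc m) 0
      ≈⟨ +-cong (+-cong (shanks-identity m) (-‿cong (*-congˡ (shanksTerm-zero m)))) (shanksTerm-zero (suc m)) ⟩
    eulerSum m - A * (s * q ^ pentPlus m) + (- 1# * s) * q ^ pentPlus (suc m)
      ≈⟨ solve 5 (λ E A s P P′ → E :- A :* (s :* P) :+ (:- con 1ℤ :* s) :* P′
                                   := E :+ (:- con 1ℤ :* s) :* (P′ :+ A :* P))
               refl (eulerSum m) A s (q ^ pentPlus m) (q ^ pentPlus (suc m)) ⟩
    eulerSum m + (- 1# * s) * (q ^ pentPlus (suc m) + A * q ^ pentPlus m)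
      ≈⟨ +-congˡ (*-congˡ (+-congˡ (trans (sym (^-homo-* q (suc m ℕ.+ m) (pentPlus m)))
                                          (^-congʳ q (≡.sym (pentMinus-suc m)))))) ⟩
    eulerSum (suc m)
      ∎
    where
    s = (- 1#) ^ m
    A = q ^ (suc m ℕ.+ m)

  shanksTerm-≈0-mod : ∀ k d → shanksTerm (suc k) d ≈ 0# mod q ^ suc (suc k ℕ.+ d)
  shanksTerm-≈0-mod k d = ≈mod-respʳ (trans (*-congˡ (zeroˡ _)) (zeroʳ _))
    (*-congˡ-mod ((- 1#) ^ suc k) (*-congʳ-mod (pochhammer (suc k) d) (^-≈0-mod q exponent≥)))
    where
    n = suc k ℕ.+ d
    exponent≥ : suc n ℕ.≤ n ℕ.* suc k ℕ.+ triangular (suc k)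
    exponent≥ = ≡.subst (ℕ._≤ n ℕ.* suc k ℕ.+ triangular (suc k)) (ℕ.+-comm n 1)
      (ℕ.+-mono-≤ (ℕ.m≤m*n n (suc k)) (ℕ.≤-trans (s≤s z≤n) (ℕ.m≤n+m (suc k) (triangular k))))

  shanksSum≈eulerProduct : ∀ m → shanksSum m ≈ eulerProduct m mod q ^ suc m
  shanksSum≈eulerProduct m = ≈mod-respʳ first (∑<-≈-head-mod m _ rest)
    where
    first : shanksTerm 0 m ≈ eulerProduct m
    first = trans (*-identityˡ _)
                  (trans (*-congʳ (^-congʳ q (≡.trans (ℕ.+-identityʳ _) (ℕ.*-zeroʳ m)))) (*-identityˡ _))
    rest : ∀ k → k ℕ.< m → shanksTerm (suc k) (m ∸ suc k) ≈ 0# mod q ^ suc m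
    rest k k<m = ≡.subst (λ n → shanksTerm (suc k) (m ∸ suc k) ≈ 0# mod q ^ suc n) (ℕ.m+[n∸m]≡n k<m)
                         (shanksTerm-≈0-mod k (m ∸ suc k))

  pentagonal-number-theorem : ∀ m → eulerProduct m ≈ eulerSum m mod q ^ suc m
  pentagonal-number-theorem m = ≈mod-respʳ (shanks-identity m) (≈mod-sym (shanksSum≈eulerProduct m))

module SumToProperties where

  open import Data.Integer using (_+_; _*_)
  open import Algebra.Properties.CommutativeSemigroup ℤ.+-commutativeSemigroup using (interchange)
  open ≡.≡-Reasoning
  open ≡ using (cong; cong₂)

  sumTo-cong : ∀ n {f g : ℕ → ℤ} → (∀ i → i ℕ.≤ n → f i ≡ g i) → sumTo n f ≡ sumTo n g
  sumTo-cong zero    f≡g = f≡g 0 z≤n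
  sumTo-cong (suc n) f≡g =
    cong₂ _+_ (sumTo-cong n (λ i i≤n → f≡g i (ℕ.m≤n⇒m≤1+n i≤n))) (f≡g (suc n) ℕ.≤-refl)

  sumTo-≡0 : ∀ n {f : ℕ → ℤ} → (∀ i → i ℕ.≤ n → f i ≡ 0ℤ) → sumTo n f ≡ 0ℤ
  sumTo-≡0 zero    f≡0 = f≡0 0 z≤n
  sumTo-≡0 (suc n) f≡0 =
    cong₂ _+_ (sumTo-≡0 n (λ i i≤n → f≡0 i (ℕ.m≤n⇒m≤1+n i≤n))) (f≡0 (suc n) ℕ.≤-refl)

  sumTo-+ : ∀ n (f g : ℕ → ℤ) → sumTo n (λ i → f i + g i) ≡ sumTo n f + sumTo n g
  sumTo-+ zero    f g = ≡.refl
  sumTo-+ (suc n) f g = ≡.trans (cong (_+ (f (suc n) + g (suc n))) (sumTo-+ n f g))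
                                (interchange (sumTo n f) (sumTo n g) (f (suc n)) (g (suc n)))

  sumTo-*ˡ : ∀ n c (f : ℕ → ℤ) → sumTo n (λ i → c * f i) ≡ c * sumTo n f
  sumTo-*ˡ zero    c f = ≡.refl
  sumTo-*ˡ (suc n) c f = ≡.trans (cong (_+ c * f (suc n)) (sumTo-*ˡ n c f)) (≡.sym (ℤ.*-distribˡ-+ c _ _))

  sumTo-suc : ∀ n (f : ℕ → ℤ) → sumTo (suc n) f ≡ f 0 + sumTo n (f ∘ suc)
  sumTo-suc zero    f = ≡.refl
  sumTo-suc (suc n) f = ≡.trans (cong (_+ f (suc (suc n))) (sumTo-suc n f)) (ℤ.+-assoc (f 0) _ _)

  sumTo-reverse : ∀ n (f : ℕ → ℤ) → sumTo n f ≡ sumTo n (λ i → f (n ∸ i))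
  sumTo-reverse zero    f = ≡.refl
  sumTo-reverse (suc n) f = begin
    sumTo n f + f (suc n)                       ≡⟨ cong (_+ f (suc n)) (sumTo-reverse n f) ⟩
    sumTo n (λ i → f (n ∸ i)) + f (suc n)       ≡⟨ ℤ.+-comm _ (f (suc n)) ⟩
    f (suc n) + sumTo n (λ i → f (n ∸ i))       ≡⟨ sumTo-suc n (λ i → f (suc n ∸ i)) ⟨
    sumTo (suc n) (λ i → f (suc n ∸ i))         ∎

  sumTo-triangle : ∀ n (F : ℕ → ℕ → ℤ) →
    sumTo n (λ a → sumTo a (λ i → F i a)) ≡ sumTo n (λ i → sumTo (n ∸ i) (λ j → F i (i ℕ.+ j)))
  sumTo-triangle zero    F = ≡.refl
  sumTo-triangle (suc n) F = begin
    sumTo n (λ a → sumTo a (λ i → F i a)) + (sumTo n (λ i → F i (suc n)) + F (suc n) (suc n))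
      ≡⟨ cong (_+ (sumTo n (λ i → F i (suc n)) + F (suc n) (suc n))) (sumTo-triangle n F) ⟩
    sumTo n (inner n) + (sumTo n (λ i → F i (suc n)) + F (suc n) (suc n))
      ≡⟨ ℤ.+-assoc (sumTo n (inner n)) _ _ ⟨
    sumTo n (inner n) + sumTo n (λ i → F i (suc n)) + F (suc n) (suc n)
      ≡⟨ cong (_+ F (suc n) (suc n)) (sumTo-+ n (inner n) (λ i → F i (suc n))) ⟨
    sumTo n (λ i → inner n i + F i (suc n)) + F (suc n) (suc n)
      ≡⟨ cong₂ _+_ (sumTo-cong n extend) (cong (F (suc n)) (ℕ.+-identityʳ (suc n))) ⟨
    sumTo n (inner (suc n)) + F (suc n) (suc n ℕ.+ 0)
      ≡⟨ cong (λ d → sumTo n (inner (suc n)) + sumTo d (λ j → F (suc n) (suc n ℕ.+ j))) (ℕ.n∸n≡0 n) ⟨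
    sumTo (suc n) (inner (suc n))  ∎
    where
    inner : ℕ → ℕ → ℤ
    inner n i = sumTo (n ∸ i) (λ j → F i (i ℕ.+ j))
    extend : ∀ i → i ℕ.≤ n → inner (suc n) i ≡ inner n i + F i (suc n)
    extend i i≤n rewrite ℕ.+-∸-assoc 1 i≤n =
      cong (λ m → inner n i + F i m) (≡.trans (ℕ.+-suc i (n ∸ i)) (cong suc (ℕ.m+[n∸m]≡n i≤n)))

module PowerSeries where

  open SumToProperties
  open import Data.Integer using (_+_; _*_; -_)
  open import Data.Integer.Divisibility.Signed as Signed using () renaming (_∣_ to _∣ₛ_)
  open import Algebra.Structures using (IsCommutativeRing)
  open import Relation.Binary.Bundles using (Setoid)
  open import Relation.Binary.PropositionalEquality using (_≗_; _→-setoid_; cong; cong₂)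
  open ≡.≡-Reasoning

  infixl 6 _+ₛ_
  _+ₛ_ : Series → Series → Series
  (f +ₛ g) n = f n + g n

  -ₛ_ : Series → Series
  (-ₛ f) n = - f n

  0ₛ : Series
  0ₛ _ = 0ℤ

  ⊛-comm : ∀ f g → f ⊛ g ≗ g ⊛ f
  ⊛-comm f g n = ≡.trans (sumTo-reverse n (λ i → f i * g (n ∸ i))) (sumTo-cong n swap)
    where
    swap : ∀ i → i ℕ.≤ n → f (n ∸ i) * g (n ∸ (n ∸ i)) ≡ g i * f (n ∸ i)
    swap i i≤n = ≡.trans (cong (λ j → f (n ∸ i) * g j) (ℕ.m∸[m∸n]≡n i≤n)) (ℤ.*-comm (f (n ∸ i)) (g i))

  ⊛-identityˡ : ∀ f → one ⊛ f ≗ f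
  ⊛-identityˡ f zero    = ℤ.*-identityˡ (f 0)
  ⊛-identityˡ f (suc n) = begin
    sumTo (suc n) (λ i → one i * f (suc n ∸ i))            ≡⟨ sumTo-suc n _ ⟩
    1ℤ * f (suc n) + sumTo n (λ i → 0ℤ * f (n ∸ i))
      ≡⟨ cong₂ _+_ (ℤ.*-identityˡ (f (suc n))) (sumTo-≡0 n (λ _ _ → ≡.refl)) ⟩
    f (suc n) + 0ℤ                                         ≡⟨ ℤ.+-identityʳ (f (suc n)) ⟩
    f (suc n)                                              ∎

  ⊛-distribˡ : ∀ f g h → f ⊛ (g +ₛ h) ≗ f ⊛ g +ₛ f ⊛ h
  ⊛-distribˡ f g h n = ≡.trans (sumTo-cong n (λ i _ → ℤ.*-distribˡ-+ (f i) (g (n ∸ i)) (h (n ∸ i))))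
    (sumTo-+ n (λ i → f i * g (n ∸ i)) (λ i → f i * h (n ∸ i)))

  ⊛-assoc : ∀ f g h → (f ⊛ g) ⊛ h ≗ f ⊛ (g ⊛ h)
  ⊛-assoc f g h n = begin
    sumTo n (λ a → sumTo a (λ i → f i * g (a ∸ i)) * h (n ∸ a))
      ≡⟨ sumTo-cong n (λ a _ → ≡.trans (ℤ.*-comm _ (h (n ∸ a))) (≡.sym (sumTo-*ˡ a (h (n ∸ a)) _))) ⟩
    sumTo n (λ a → sumTo a (λ i → h (n ∸ a) * (f i * g (a ∸ i))))
      ≡⟨ sumTo-triangle n (λ i a → h (n ∸ a) * (f i * g (a ∸ i))) ⟩
    sumTo n (λ i → sumTo (n ∸ i) (λ j → h (n ∸ (i ℕ.+ j)) * (f i * g (i ℕ.+ j ∸ i))))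
      ≡⟨ sumTo-cong n (λ i _ → sumTo-cong (n ∸ i) (λ j _ → regroup i j)) ⟩
    sumTo n (λ i → sumTo (n ∸ i) (λ j → f i * (g j * h (n ∸ i ∸ j))))
      ≡⟨ sumTo-cong n (λ i _ → sumTo-*ˡ (n ∸ i) (f i) _) ⟩
    sumTo n (λ i → f i * sumTo (n ∸ i) (λ j → g j * h (n ∸ i ∸ j))) ∎
    where
    regroup : ∀ i j → h (n ∸ (i ℕ.+ j)) * (f i * g (i ℕ.+ j ∸ i)) ≡ f i * (g j * h (n ∸ i ∸ j))
    regroup i j rewrite ℕ.m+n∸m≡n i j | ℕ.∸-+-assoc n i j =
      ≡.trans (ℤ.*-comm (h (n ∸ (i ℕ.+ j))) (f i * g j)) (ℤ.*-assoc (f i) (g j) _)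

  isCommutativeRing : IsCommutativeRing _≗_ _+ₛ_ _⊛_ -ₛ_ 0ₛ one
  isCommutativeRing = record
    { isRing = record
      { +-isAbelianGroup = record
        { isGroup = record
          { isMonoid = record
            { isSemigroup = record
              { isMagma = record
                { isEquivalence = Setoid.isEquivalence (ℕ →-setoid ℤ)
                ; ∙-cong        = λ f≗f′ g≗g′ n → cong₂ _+_ (f≗f′ n) (g≗g′ n)
                }
              ; assoc = λ f g h n → ℤ.+-assoc (f n) (g n) (h n)
              }
            ; identity = (λ f n → ℤ.+-identityˡ (f n)) , (λ f n → ℤ.+-identityʳ (f n))
            }
          ; inverse = (λ f n → ℤ.+-inverseˡ (f n)) , (λ f n → ℤ.+-inverseʳ (f n))
          ; ⁻¹-cong = λ f≗g n → cong -_ (f≗g n)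
          }
        ; comm = λ f g n → ℤ.+-comm (f n) (g n)
        }
      ; *-cong     = λ f≗f′ g≗g′ n → sumTo-cong n (λ i _ → cong₂ _*_ (f≗f′ i) (g≗g′ (n ∸ i)))
      ; *-assoc    = ⊛-assoc
      ; *-identity = ⊛-identityˡ , (λ f n → ≡.trans (⊛-comm f one n) (⊛-identityˡ f n))
      ; distrib    = ⊛-distribˡ , (λ f g h n → ≡.trans (⊛-comm (g +ₛ h) f n)
                                     (≡.trans (⊛-distribˡ f g h n) (cong₂ _+_ (⊛-comm f g n) (⊛-comm f h n))))
      }
    ; *-comm = ⊛-comm
    }

  ring : CommutativeRing 0ℓ 0ℓ
  ring = record { isCommutativeRing = isCommutativeRing }

  open CommutativeRing ring using (1#; _-_)
  open FiniteProducts ring using (∏<)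
  open Congruence ring using (_≈_mod_)
  open import Algebra.Properties.Semiring.Exp (CommutativeRing.semiring ring) using (_^_)
  open import Algebra.Properties.Semiring.Mult (CommutativeRing.semiring ring) using (_×_)

  X : Series
  X (suc zero) = 1ℤ
  X _          = 0ℤ

  X⊛-suc : ∀ f n → (X ⊛ f) (suc n) ≡ f n
  X⊛-suc f n = ≡.trans (sumTo-suc n _) (≡.trans (ℤ.+-identityˡ _) (only-first n))
    where
    only-first : ∀ n → sumTo n (λ i → X (suc i) * f (n ∸ i)) ≡ f n
    only-first zero    = ℤ.*-identityˡ (f 0)
    only-first (suc n) = ≡.trans (sumTo-suc n _)
      (≡.trans (cong₂ _+_ (ℤ.*-identityˡ (f (suc n))) (sumTo-≡0 n (λ _ _ → ≡.refl))) (ℤ.+-identityʳ _))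

  Supported : (ℕ → Set) → Series → Set
  Supported S f = ∀ n → ¬ S n → f n ≡ 0ℤ

  X^-self : ∀ a → (X ^ a) a ≡ 1ℤ
  X^-self zero    = ≡.refl
  X^-self (suc a) = ≡.trans (X⊛-suc (X ^ a) a) (X^-self a)

  X^-supported : ∀ a → Supported (_≡ a) (X ^ a)
  X^-supported zero    zero    0≢0     = contradiction ≡.refl 0≢0
  X^-supported zero    (suc n) _       = ≡.refl
  X^-supported (suc a) zero    _       = ≡.refl
  X^-supported (suc a) (suc n) 1+n≢1+a = ≡.trans (X⊛-suc (X ^ a) n) (X^-supported a n (1+n≢1+a ∘ cong suc))

  oneMinusQ^≗1-X^ : ∀ m → oneMinusQ^ (suc m) ≗ 1# - X ^ suc m
  oneMinusQ^≗1-X^ m zero    = ≡.sym (cong (λ c → 1ℤ + - c) (X^-supported (suc m) 0 (λ ())))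
  oneMinusQ^≗1-X^ m (suc j) with suc j ℕ.≟ suc m
  ... | yes ≡.refl rewrite dec-true (suc j ℕ.≟ suc j) ≡.refl =
    ≡.sym (cong (λ c → 0ℤ + - c) (X^-self (suc j)))
  ... | no  j≢m    rewrite dec-false (suc j ℕ.≟ suc m) j≢m =
    ≡.sym (cong (λ c → 0ℤ + - c) (X^-supported (suc m) (suc j) j≢m))

  Supported-mono : ∀ {S T : ℕ → Set} {f} → (∀ {n} → S n → T n) → Supported S f → Supported T f
  Supported-mono S⊆T f-supp n ¬Tn = f-supp n (¬Tn ∘ S⊆T)

  Supported-+ : ∀ {S f g} → Supported S f → Supported S g → Supported S (f +ₛ g)
  Supported-+ f-supp g-supp n ¬Sn = cong₂ _+_ (f-supp n ¬Sn) (g-supp n ¬Sn)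

  Supported-neg : ∀ {S f} → Supported S f → Supported S (-ₛ f)
  Supported-neg f-supp n ¬Sn = cong -_ (f-supp n ¬Sn)

  Supported-cong : ∀ {S f g} → f ≗ g → Supported S f → Supported S g
  Supported-cong f≗g f-supp n ¬Sn = ≡.trans (≡.sym (f≗g n)) (f-supp n ¬Sn)

  Supported-one : ∀ {S} → S 0 → Supported S one
  Supported-one S0 zero    ¬S0 = contradiction S0 ¬S0
  Supported-one S0 (suc n) _   = ≡.refl

  -- No decidability of S or T is needed: it is enough to decide whether each coefficient is zero.
  Supported-⊛ : ∀ {S T U : ℕ → Set} {f g} → (∀ {i j} → S i → T j → U (i ℕ.+ j)) →
                Supported S f → Supported T g → Supported U (f ⊛ g)
  Supported-⊛ {S} {T} {U} {f} {g} closed f-supp g-supp n ¬Un = sumTo-≡0 n term≡0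
    where
    term≡0 : ∀ i → i ℕ.≤ n → f i * g (n ∸ i) ≡ 0ℤ
    term≡0 i i≤n with f i ℤ.≟ 0ℤ | g (n ∸ i) ℤ.≟ 0ℤ
    ... | yes fi≡0 | _        = cong (_* g (n ∸ i)) fi≡0
    ... | no  _    | yes gj≡0 = ≡.trans (cong (f i *_) gj≡0) (ℤ.*-zeroʳ (f i))
    ... | no  fi≢0 | no gj≢0  = contradiction (f-supp i λ Si → gj≢0 (g-supp (n ∸ i) λ Tj →
                                  ¬Un (≡.subst U (ℕ.m+[n∸m]≡n i≤n) (closed Si Tj)))) fi≢0

  module _ {S : ℕ → Set} (S0 : S 0) (S-+ : ∀ {i j} → S i → S j → S (i ℕ.+ j)) where

    Supported-∏< : ∀ n {f} → (∀ i → Supported S (f i)) → Supported S (∏< n f)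
    Supported-∏< zero    f-supp = Supported-one S0
    Supported-∏< (suc n) f-supp = Supported-⊛ S-+ (f-supp n) (Supported-∏< n f-supp)

    Supported-^ : ∀ {f} k → Supported S f → Supported S (f ^ k)
    Supported-^ zero    f-supp = Supported-one S0
    Supported-^ (suc k) f-supp = Supported-⊛ S-+ f-supp (Supported-^ k f-supp)

  ⊛-constant : ∀ {c} f n → Supported (_≡ 0) c → (c ⊛ f) n ≡ c 0 * f n
  ⊛-constant f zero    c-supp = ≡.refl
  ⊛-constant {c} f (suc n) c-supp = ≡.trans (sumTo-suc n _)
    (≡.trans (cong (c 0 * f (suc n) +_) (sumTo-≡0 n (λ i _ → cong (_* f (n ∸ i)) (c-supp (suc i) λ ()))))
             (ℤ.+-identityʳ _))

  ×-coefficient : ∀ k f n → (k × f) n ≡ ℤ.+ k * f n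
  ×-coefficient zero    f n = ≡.sym (ℤ.*-zeroˡ (f n))
  ×-coefficient (suc k) f n = begin
    f n + (k × f) n              ≡⟨ cong (f n +_) (×-coefficient k f n) ⟩
    f n + ℤ.+ k * f n            ≡⟨ cong (_+ ℤ.+ k * f n) (ℤ.*-identityˡ (f n)) ⟨
    1ℤ * f n + ℤ.+ k * f n       ≡⟨ ℤ.*-distribʳ-+ (f n) 1ℤ (ℤ.+ k) ⟨
    ℤ.+ suc k * f n              ∎

  ≈mod-X^-coefficient : ∀ {f g} a n → f ≈ g mod X ^ a → n ℕ.< a → f n ≡ g n
  ≈mod-X^-coefficient {f} {g} a n (z , f≈g+Xᵃz) n<a = begin
    f n                     ≡⟨ f≈g+Xᵃz n ⟩
    g n + ((X ^ a) ⊛ z) n   ≡⟨ cong (g n +_) (sumTo-≡0 n λ i i≤n → cong (_* z (n ∸ i)) (X^-supported a i (below i≤n))) ⟩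
    g n + 0ℤ                ≡⟨ ℤ.+-identityʳ (g n) ⟩
    g n                     ∎
    where
    below : ∀ {i} → i ℕ.≤ n → i ≢ a
    below i≤n ≡.refl = ℕ.<⇒≱ n<a i≤n

  ≈mod-×-divisible : ∀ {f g} k n → f ≈ g mod k × 1# → ℤ.+ k ∣ₛ g n → ℤ.+ k ∣ₛ f n
  ≈mod-×-divisible {f} {g} k n (z , f≈g+kz) k∣gn =
    ≡.subst (ℤ.+ k ∣ₛ_) (≡.sym (f≈g+kz n)) (Signed.∣m∣n⇒∣m+n k∣gn k∣kz)
    where
    k×1-supported : Supported (_≡ 0) (k × 1#)
    k×1-supported (suc i) _ = ≡.trans (×-coefficient k one (suc i)) (ℤ.*-zeroʳ (ℤ.+ k))
    k×1-supported zero    0≢0 = contradiction ≡.refl 0≢0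
    k∣kz : ℤ.+ k ∣ₛ ((k × 1#) ⊛ z) n
    k∣kz = ≡.subst (ℤ.+ k ∣ₛ_)
      (≡.sym (≡.trans (⊛-constant z n k×1-supported) (cong (_* z n) (×-coefficient k one 0))))
      (Signed.∣m⇒∣m*n (z n) (Signed.∣m⇒∣m*n 1ℤ Signed.∣-refl))

  ^ₙ≡^ : ∀ f j → f ^ₙ j ≡ f ^ j
  ^ₙ≡^ f zero    = ≡.refl
  ^ₙ≡^ f (suc j) = cong (f ⊛_) (^ₙ≡^ f j)

  prodTo≡∏< : ∀ n j → prodTo n (ℤ.+ j) ≡ ∏< n (λ i → oneMinusQ^ (suc i) ^ j)
  prodTo≡∏< zero    j = ≡.refl
  prodTo≡∏< (suc n) j = cong₂ _⊛_ (^ₙ≡^ (oneMinusQ^ (suc n)) j) (prodTo≡∏< n j)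

Pentagonal : ℕ → Set
Pentagonal i = ∃ λ r → pentPlus r ≡ i ⊎ pentMinus r ≡ i

module _ where
  open PowerSeries
  open CommutativeRing ring using (_*_; 1#; -_; _-_; sym)
  open FiniteProducts ring
  open Congruence ring
  open PentagonalNumberTheorem ring X
  open Frobenius ring using (∏<-[1-x]^[1+p]-mod)
  open import Algebra.Properties.Semiring.Mult (CommutativeRing.semiring ring) using (_×_)
  open import Algebra.Properties.Semiring.Exp (CommutativeRing.semiring ring) using (_^_; ^-congˡ; ^-assocʳ)
  open import Data.Integer.Divisibility.Signed using (divides) renaming (_∣_ to _∣ₛ_)

  eulerSum-supported : ∀ m → Supported Pentagonal (eulerSum m)
  eulerSum-supported zero    = Supported-one (0 , inj₁ ≡.refl)
  eulerSum-supported (suc m) = Supported-+ (eulerSum-supported m)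
    (Supported-⊛ (λ { ≡.refl Pj → Pj }) sign-supported
      (Supported-+ (Supported-mono (λ { ≡.refl → suc m , inj₁ ≡.refl }) (X^-supported _))
                   (Supported-mono (λ { ≡.refl → suc m , inj₂ ≡.refl }) (X^-supported _))))
    where
    sign-supported : Supported (_≡ 0) ((- 1#) ^ suc m)
    sign-supported =
      Supported-^ ≡.refl (λ { ≡.refl ≡.refl → ≡.refl }) (suc m) (Supported-neg (Supported-one ≡.refl))

  ∏<[1-X^ᵖ]-supported : ∀ p n → Supported (p ∣_) (∏< n (λ i → 1# - (X ^ suc i) ^ p))
  ∏<[1-X^ᵖ]-supported p n = Supported-∏< (p ∣0) ∣m∣n⇒∣m+n n λ i →
    Supported-+ (Supported-one (p ∣0)) (Supported-neg (Supported-cong (sym (^-assocʳ X (suc i) p))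
      (Supported-mono (λ { ≡.refl → n∣m*n (suc i) }) (X^-supported (suc i ℕ.* p)))))

  prodTo-coefficient-divisible : ∀ {p} → Prime p → ∀ n →
    (∀ {i j} → Pentagonal i → p ∣ j → i ℕ.+ j ≢ n) → ℤ.+ p ∣ₛ prodTo (suc n) (ℤ.+ suc p) n
  prodTo-coefficient-divisible {p} p-prime n avoids =
    ≈mod-×-divisible {prodTo N (ℤ.+ suc p)} {A * B} p n factorised
      (≡.subst (ℤ.+ p ∣ₛ_) (≡.sym AB[n]≡0) (divides 0ℤ ≡.refl))
    where
    N = suc n
    A = eulerProduct N
    B = ∏< N (λ i → 1# - (X ^ suc i) ^ p)
    factorised : prodTo N (ℤ.+ suc p) ≈ A * B mod p × 1#
    factorised = begin
      prodTo N (ℤ.+ suc p)                       ≡⟨ prodTo≡∏< N (suc p) ⟩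
      ∏< N (λ i → oneMinusQ^ (suc i) ^ suc p)    ≈⟨ ∏<-cong N (λ i → ^-congˡ (suc p) (oneMinusQ^≗1-X^ i)) ⟩
      ∏< N (λ i → (1# - X ^ suc i) ^ suc p)      ≲⟨ ∏<-[1-x]^[1+p]-mod p-prime N (λ i → X ^ suc i) ⟩
      A * B                                      ∎
      where open import Relation.Binary.Reasoning.Preorder (≈mod-preorder {p × 1#})
    AB≈EB : A * B ≈ eulerSum N * B mod X ^ suc N
    AB≈EB = *-congʳ-mod {X ^ suc N} {A} {eulerSum N} B (pentagonal-number-theorem N)
    EB[n]≡0 : (eulerSum N * B) n ≡ 0ℤ
    EB[n]≡0 = Supported-⊛ {U = _≢ n} avoids (eulerSum-supported N) (∏<[1-X^ᵖ]-supported p N) n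
                          (λ n≢n → n≢n ≡.refl)
    AB[n]≡0 : (A * B) n ≡ 0ℤ
    AB[n]≡0 = ≡.trans (≈mod-X^-coefficient {A * B} {eulerSum N * B} (suc N) n AB≈EB (ℕ.m<n⇒m<1+n ℕ.≤-refl))
                      EB[n]≡0

open import Data.Nat using (_≤_)
open import Data.Integer using (+_; _-_)
open import Data.Integer.Divisibility using () renaming (_∣_ to _∣ℤ_)
open import Data.Integer.Divisibility.Signed using (∣⇒∣ᵤ)
open import Data.Integer.Tactic.RingSolver using () renaming (solve-∀ to ℤ-solve-∀)

mainTheorem3 : (n : ℕ) → 1 ≤ n → (k : ℤ) → (p : ℕ) → Prime p → k - + 1 ≡ + p →
    ((r : ℕ) → pentPlus r ≤ n ∸ 1 → ¬ (p ∣ (n ∸ 1 ∸ pentPlus r))) →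
    ((r : ℕ) → pentMinus r ≤ n ∸ 1 → ¬ (p ∣ (n ∸ 1 ∸ pentMinus r))) →
    (+ p) ∣ℤ τ k n
mainTheorem3 zero    ()
mainTheorem3 (suc n) _ k p p-prime k-1≡p hP hM =
  ≡.subst (λ k → + p ∣ℤ τ k (suc n)) (≡.sym k≡1+p) (∣⇒∣ᵤ (prodTo-coefficient-divisible p-prime n avoids))
  where
  k≡k-1+1 : ∀ k → k ≡ k - + 1 ℤ.+ + 1
  k≡k-1+1 = ℤ-solve-∀
  k≡1+p : k ≡ + suc p
  k≡1+p = ≡.trans (k≡k-1+1 k) (≡.trans (≡.cong (ℤ._+ + 1) k-1≡p) (ℤ.+-comm (+ p) (+ 1)))
  excluded : ∀ i → Pentagonal i → i ≤ n → ¬ p ∣ n ∸ i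
  excluded i (r , inj₁ ≡.refl) = hP r
  excluded i (r , inj₂ ≡.refl) = hM r
  avoids : ∀ {i j} → Pentagonal i → p ∣ j → i ℕ.+ j ≢ n
  avoids {i} {j} i-pentagonal p∣j i+j≡n = excluded i i-pentagonal
    (≡.subst (i ≤_) i+j≡n (ℕ.m≤m+n i j))
    (≡.subst (λ m → p ∣ m ∸ i) i+j≡n (≡.subst (p ∣_) (≡.sym (ℕ.m+n∸m≡n i j)) p∣j))
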